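{- Let $\mathsf{C}$ be a category, $Q:\mathsf{C}\to\mathsf{Pos}$ a functor that factors through $\mathsf{SLatt}$, $F:(\mathsf{C}^{op})^{n}\times\mathsf{C}^{m}\to\mathsf{C}$ a functor, and $\psi:\prod Q^{n+m}\to Q\circ F$ a lax extranatural transformation. Then for all arrows $f:X\to X'$ in $\mathsf{C}^n$, $g:Y\to Y'$ in $\mathsf{C}^m$, and all $x'\in Q(X')$, $y\in Q(Y)$, $$Q(F(f,g))\big(\psi_{X',Y}(x',y)\big)\le \psi_{X,Y'}\big(Q(f)^{*}(x'),\,Q(g)(y)\big),$$ where $Q(f)^{*}=\prod_i Q(f_i)^{*}$ and $Q(f_i)^{*}$ denotes the right adjoint of $Q(f_i)$.
   Context: $Q$ factors through $\mathsf{SLatt}$ means: each $Q(X)$ is a complete lattice and each $Q(f)$ preserves all suprema (hence has a right adjoint $Q(f)^*$, i.e. $Q(f)(a)\le b\iff a\le Q(f)^*(b)$). For $X=(X_1,\dots,X_k)$ write $Q(X)=\prod_i Q(X_i)$ and $Q(f)=\prod_iQ(f_i)$. A lax extranatural transformation $\psi:\prod Q^{n+m}\to Q\circ F$ is a family of monotone maps $\psi_{X,Y}:\prod_{i}Q(X_i)^{op}\times\prod_j Q(Y_j)\to Q(F(X,Y))$, indexed by objects $X$ of $\mathsf{C}^n$, $Y$ of $\mathsf{C}^m$, such that for all $f:X\to X'$ in $\mathsf{C}^n$, $g:Y\to Y'$ in $\mathsf{C}^m$, $x\in Q(X)$, $y\in Q(Y)$: $Q(F(f,g))(\psi_{X',Y}(Q(f)(x),y))\le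 \psi_{X,Y'}(x,Q(g)(y))$. -}

module Defs where

open import Level using (Level; _⊔_; suc)
open import Data.Fin using (Fin)
open import Data.Nat using (ℕ)
open import Data.Product using (Σ; proj₁)
open import Relation.Binary.Bundles using (Poset)
open import Relation.Binary.Structures using (IsEquivalence)

record Category (o ℓ e : Level) : Set (suc (o ⊔ ℓ ⊔ e)) where
  infixr 9 _∘_
  infix  4 _≈_
  field
    Obj   : Set o
    Hom   : Obj → Obj → Set ℓ
    _≈_   : ∀ {A B} → Hom A B → Hom A B → Set e
    id    : ∀ {A} → Hom A A
    _∘_   : ∀ {A B C} → Hom B C → Hom A B → Hom A C
    ≈-equiv   : ∀ {A B} → IsEquivalence (_≈_ {A} {B})
    ∘-resp-≈  : ∀ {A B C} {f f' : Hom B C} {g g' : Hom A B} →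
                f ≈ f' → g ≈ g' → f ∘ g ≈ f' ∘ g'
    identityˡ : ∀ {A B} {f : Hom A B} → id ∘ f ≈ f
    identityʳ : ∀ {A B} {f : Hom A B} → f ∘ id ≈ f
    assoc     : ∀ {A B C D} {f : Hom A B} {g : Hom B C} {h : Hom C D} →
                (h ∘ g) ∘ f ≈ h ∘ (g ∘ f)

-- Complete lattices: posets with all suprema of families indexed by
-- types of level (c ⊔ ℓ₂) (enough for all subsets of the carrier).

record IsCompleteLattice {c ℓ₁ ℓ₂} (P : Poset c ℓ₁ ℓ₂) : Set (suc (c ⊔ ℓ₂) ⊔ c ⊔ ℓ₁ ⊔ ℓ₂) where
  open Poset P
  field
    ⋁      : {I : Set (c ⊔ ℓ₂)} → (I → Carrier) → Carrier
    ⋁-ub   : {I : Set (c ⊔ ℓ₂)} (a : I → Carrier) (i : I) → a i ≤ ⋁ a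
    ⋁-least : {I : Set (c ⊔ ℓ₂)} (a : I → Carrier) (b : Carrier) →
              (∀ i → a i ≤ b) → ⋁ a ≤ b

record SLattFunctor {o ℓ e} (C : Category o ℓ e) (c ℓ₁ ℓ₂ : Level)
       : Set (o ⊔ ℓ ⊔ e ⊔ suc (c ⊔ ℓ₁ ⊔ ℓ₂)) where
  open Category C
  field
    Q₀    : Obj → Poset c ℓ₁ ℓ₂
    Q₀-complete : ∀ A → IsCompleteLattice (Q₀ A)
  Q∣_∣ : Obj → Set c
  Q∣ A ∣ = Poset.Carrier (Q₀ A)
  field
    Q₁    : ∀ {A B} → Hom A B → Q∣ A ∣ → Q∣ B ∣
    Q₁-mono : ∀ {A B} (f : Hom A B) {x y} →
              Poset._≤_ (Q₀ A) x y → Poset._≤_ (Q₀ B) (Q₁ f x) (Q₁ f y)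
    Q₁-cong : ∀ {A B} (f : Hom A B) {x y} →
              Poset._≈_ (Q₀ A) x y → Poset._≈_ (Q₀ B) (Q₁ f x) (Q₁ f y)
    Q₁-resp-≈ : ∀ {A B} {f g : Hom A B} → f ≈ g →
                ∀ x → Poset._≈_ (Q₀ B) (Q₁ f x) (Q₁ g x)
    Q-identity : ∀ {A} x → Poset._≈_ (Q₀ A) (Q₁ (id {A}) x) x
    Q-homomorphism : ∀ {A B D} (f : Hom A B) (g : Hom B D) x →
                     Poset._≈_ (Q₀ D) (Q₁ (g ∘ f) x) (Q₁ g (Q₁ f x))
    Q₁-⋁ : ∀ {A B} (f : Hom A B) {I : Set (c ⊔ ℓ₂)} (a : I → Q∣ A ∣) →
           Poset._≈_ (Q₀ B) (Q₁ f (IsCompleteLattice.⋁ (Q₀-complete A) a))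
                            (IsCompleteLattice.⋁ (Q₀-complete B) (λ i → Q₁ f (a i)))

  -- The right adjoint Q(f)^* of Q(f): Q(f)^*(b) = ⋁ { a | Q(f)(a) ≤ b }.
  Q₁* : ∀ {A B} → Hom A B → Q∣ B ∣ → Q∣ A ∣
  Q₁* {A} {B} f b =
    IsCompleteLattice.⋁ (Q₀-complete A)
      {I = Σ Q∣ A ∣ (λ a → Poset._≤_ (Q₀ B) (Q₁ f a) b)} proj₁

module _ {o ℓ e} (C : Category o ℓ e) where
  open Category C

  Objs : ℕ → Set o
  Objs n = Fin n → Obj

  Homs : ∀ {n} → Objs n → Objs n → Set ℓ
  Homs X X' = ∀ i → Hom (X i) (X' i)

  record MixedFunctor (n m : ℕ) : Set (o ⊔ ℓ ⊔ e) where
    field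
      F₀ : Objs n → Objs m → Obj
      F₁ : ∀ {X X' : Objs n} {Y Y' : Objs m} →
           Homs X X' → Homs Y Y' → Hom (F₀ X' Y) (F₀ X Y')
      F-resp-≈ : ∀ {X X' : Objs n} {Y Y' : Objs m}
                   {f f' : Homs X X'} {g g' : Homs Y Y'} →
                 (∀ i → f i ≈ f' i) → (∀ j → g j ≈ g' j) → F₁ f g ≈ F₁ f' g'
      F-identity : ∀ {X : Objs n} {Y : Objs m} →
                   F₁ {X} {X} {Y} {Y} (λ i → id) (λ j → id) ≈ id
      F-homomorphism : ∀ {X X' X'' : Objs n} {Y Y' Y'' : Objs m}
                         (f₁ : Homs X X') (f₂ : Homs X' X'')
                         (g₁ : Homs Y Y') (g₂ : Homs Y' Y'') →
                       F₁ (λ i → f₂ i ∘ f₁ i) (λ j → g₂ j ∘ g₁ j)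
                         ≈ F₁ f₁ g₂ ∘ F₁ f₂ g₁

module _ {o ℓ e c ℓ₁ ℓ₂} {C : Category o ℓ e}
         (Q : SLattFunctor C c ℓ₁ ℓ₂) where
  open Category C
  open SLattFunctor Q

  QΠ : ∀ {n} → Objs C n → Set c
  QΠ X = ∀ i → Q∣ X i ∣

  _≤Π_ : ∀ {n} {X : Objs C n} → QΠ X → QΠ X → Set ℓ₂
  _≤Π_ {X = X} x x' = ∀ i → Poset._≤_ (Q₀ (X i)) (x i) (x' i)

  QΠ₁ : ∀ {n} {X X' : Objs C n} → Homs C X X' → QΠ X → QΠ X'
  QΠ₁ f x = λ i → Q₁ (f i) (x i)

  QΠ₁* : ∀ {n} {X X' : Objs C n} → Homs C X X' → QΠ X' → QΠ X
  QΠ₁* f x' = λ i → Q₁* (f i) (x' i)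

  record LaxExtranatural {n m} (F : MixedFunctor C n m)
         : Set (o ⊔ ℓ ⊔ c ⊔ ℓ₂) where
    open MixedFunctor F
    field
      ψ : (X : Objs C n) (Y : Objs C m) → QΠ X → QΠ Y → Q∣ F₀ X Y ∣
      ψ-mono : ∀ {X : Objs C n} {Y : Objs C m} {x x' : QΠ X} {y y' : QΠ Y} →
               x' ≤Π x → y ≤Π y' →
               Poset._≤_ (Q₀ (F₀ X Y)) (ψ X Y x y) (ψ X Y x' y')
      ψ-lax : ∀ {X X' : Objs C n} {Y Y' : Objs C m}
                (f : Homs C X X') (g : Homs C Y Y') (x : QΠ X) (y : QΠ Y) →
              Poset._≤_ (Q₀ (F₀ X Y'))
                (Q₁ (F₁ f g) (ψ X' Y (QΠ₁ f x) y))
                (ψ X Y' x (QΠ₁ g y))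

{-# OPTIONS --safe #-}
-- The counit Q(f)(Q(f)^* x') ≤ x' and antitonicity of ψ in its contravariant
-- argument give ψ(x', y) ≤ ψ(Q(f)(Q(f)^* x'), y); applying Q(F(f,g)) and the
-- lax extranaturality square at x = Q(f)^* x' finishes the proof.
module Submission where

open import Defs
open import Level using (Level)
open import Data.Nat using (ℕ)
open import Data.Product using (proj₁; proj₂)
open import Relation.Binary.Bundles using (Poset)
import Relation.Binary.Reasoning.PartialOrder as ≤-Reasoning

module _ {o ℓ e c ℓ₁ ℓ₂ : Level} {C : Category o ℓ e}
         (Q : SLattFunctor C c ℓ₁ ℓ₂) where
  open Category C using (Obj; Hom)
  open SLattFunctor Q

  Q₁-Q₁*-counit : ∀ {A B : Obj} (f : Hom A B) (b : Q∣ B ∣) →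
    Poset._≤_ (Q₀ B) (Q₁ f (Q₁* f b)) b
  Q₁-Q₁*-counit {A} {B} f b = begin
    Q₁ f (⋁ (Q₀-complete A) proj₁)              ≈⟨ Q₁-⋁ f proj₁ ⟩
    ⋁ (Q₀-complete B) (λ a → Q₁ f (proj₁ a))    ≤⟨ ⋁-least (Q₀-complete B) _ b proj₂ ⟩
    b                                           ∎
    where
    open ≤-Reasoning (Q₀ B)
    open IsCompleteLattice using (⋁; ⋁-least)

  QΠ₁-QΠ₁*-counit : ∀ {n} {X X' : Objs C n} (f : Homs C X X') (x' : QΠ Q X') →
    _≤Π_ Q (QΠ₁ Q f (QΠ₁* Q f x')) x'
  QΠ₁-QΠ₁*-counit f x' i = Q₁-Q₁*-counit (f i) (x' i)

mainTheorem2 : ∀ {o ℓ e c ℓ₁ ℓ₂ : Level} (C : Category o ℓ e)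
    (Q : SLattFunctor C c ℓ₁ ℓ₂) {n m : ℕ} (F : MixedFunctor C n m)
    (Ψ : LaxExtranatural Q F)
    {X X' : Objs C n} {Y Y' : Objs C m}
    (f : Homs C X X') (g : Homs C Y Y') (x' : QΠ Q X') (y : QΠ Q Y) →
    Poset._≤_ (SLattFunctor.Q₀ Q (MixedFunctor.F₀ F X Y'))
      (SLattFunctor.Q₁ Q (MixedFunctor.F₁ F f g) (LaxExtranatural.ψ Ψ X' Y x' y))
      (LaxExtranatural.ψ Ψ X Y' (QΠ₁* Q f x') (QΠ₁ Q g y))
mainTheorem2 C Q F Ψ {X} {X'} {Y} {Y'} f g x' y = begin
  Q₁ (F₁ f g) (ψ X' Y x' y)                     ≤⟨ Q₁-mono (F₁ f g) ψ-antitone-in-x ⟩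
  Q₁ (F₁ f g) (ψ X' Y (QΠ₁ Q f (QΠ₁* Q f x')) y) ≤⟨ ψ-lax f g (QΠ₁* Q f x') y ⟩
  ψ X Y' (QΠ₁* Q f x') (QΠ₁ Q g y)               ∎
  where
  open SLattFunctor Q using (Q₀; Q₁; Q₁-mono)
  open MixedFunctor F using (F₀; F₁)
  open LaxExtranatural Ψ
  open ≤-Reasoning (Q₀ (F₀ X Y'))
  ψ-antitone-in-x : Poset._≤_ (Q₀ (F₀ X' Y)) (ψ X' Y x' y)
                      (ψ X' Y (QΠ₁ Q f (QΠ₁* Q f x')) y)
  ψ-antitone-in-x = ψ-mono (QΠ₁-QΠ₁*-counit Q f x') (λ j → Poset.refl (Q₀ (Y j)))
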